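{- Let $p$ be a prime, $n\geq 1$ an integer, and $F_3(n)=\prod_{k=1}^n (k!)^{k!}$. Then $$\nu_p\left[F_3(n)\right]\leq\frac{(n+1)!-1}{p-1}.$$
   Context: For a prime $p$ and a positive integer $m$, $\nu_p(m)=\max\{k\in\mathbb{N}: p^k\mid m\}$ denotes the $p$-adic valuation of $m$. -}

module Defs where

open import Data.Nat using (ℕ; zero; suc; _*_; _^_; _!)

open import Data.Nat.Divisibility using (_∣_)
open import Data.Product using (_×_)
open import Relation.Nullary using (¬_)

prod1 : (ℕ → ℕ) → ℕ → ℕ
prod1 f zero    = 1
prod1 f (suc n) = prod1 f n * f (suc n)

F3 : ℕ → ℕ
F3 n = prod1 (λ k → (k !) ^ (k !)) n

IsValuation : ℕ → ℕ → ℕ → Set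
IsValuation p m k = (p ^ k ∣ m) × ¬ (p ^ suc k ∣ m)

{-# OPTIONS --safe #-}
-- Writing k = p d + r with r < p, the factors of k! divisible by p are p, 2p, …, dp, so
-- k! = p^d · d! · u with p ∤ u, and by induction on k
-- (p − 1) ν_p(k!) = (p − 1) d + (p − 1) ν_p(d!) ≤ (p − 1) d + d ≤ k.
-- Hence (p − 1) ν_p(F₃(n)) = Σ_k k! · (p − 1) ν_p(k!) ≤ Σ_k k! · k = (n + 1)! − 1.
module Submission where

open import Defs
open import Data.Nat using (ℕ; zero; suc; _+_; _*_; _∸_; _^_; _≤_; _<_; _≥_; _!; z≤n; NonZero)
open import Data.Nat.Properties
open import Data.Nat.Divisibility
open import Data.Nat.DivMod using (_/_; _%_; m≡m%n+[m/n]*n; m%n<n; m/n<m; m/n*n≤m)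
open import Data.Nat.Induction using (<-rec)
open import Data.Nat.Primality using (Prime; euclidsLemma; prime⇒nonZero; prime⇒nonTrivial)
open import Data.Nat.Base using (NonTrivial; nonTrivial⇒≢1; nonTrivial⇒n>1)
open import Data.Nat.Tactic.RingSolver using (solve-∀)
open import Data.Product using (∃₂; _×_; _,_)
open import Data.Sum using (inj₁; inj₂; [_,_])
open import Relation.Binary.Bundles using (Preorder)
import Relation.Binary.Reasoning.Preorder
open import Relation.Binary.PropositionalEquality hiding ([_])
open import Relation.Nullary using (¬_; contradiction)

private
  variable
    a b l m n A B : ℕ

sum1 : (ℕ → ℕ) → ℕ → ℕ
sum1 g zero    = 0
sum1 g (suc n) = sum1 g n + g (suc n)

-- Telescoping: k · k! = (k + 1)! − k!.
1+sum1[k!*k]≡[1+n]! : ∀ n → suc (sum1 (λ k → k ! * k) n) ≡ suc n !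
1+sum1[k!*k]≡[1+n]! zero    = refl
1+sum1[k!*k]≡[1+n]! (suc n) = begin
  suc (sum1 (λ k → k ! * k) n) + suc n ! * suc n  ≡⟨ cong (_+ suc n ! * suc n) (1+sum1[k!*k]≡[1+n]! n) ⟩
  suc n ! + suc n ! * suc n                        ≡⟨ cong (suc n ! +_) (*-comm (suc n !) (suc n)) ⟩
  suc (suc n) !                                    ∎
  where open ≡-Reasoning

module _ {p : ℕ} (p-prime : Prime p) where

  private instance
    p≢0 : NonZero p
    p≢0 = prime⇒nonZero p-prime
    p≢0,1 : NonTrivial p
    p≢0,1 = prime⇒nonTrivial p-prime

  p∤1 : ¬ p ∣ 1
  p∤1 p∣1 = nonTrivial⇒≢1 (∣1⇒≡1 p∣1)

  p∤a∧p∤b⇒p∤a*b : ¬ p ∣ a → ¬ p ∣ b → ¬ p ∣ a * b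
  p∤a∧p∤b⇒p∤a*b {a} {b} p∤a p∤b p∣ab = [ p∤a , p∤b ] (euclidsLemma a b p-prime p∣ab)

  PowerSplit : ℕ → ℕ → ℕ → Set
  PowerSplit v a b = ∃₂ λ i j → v ≡ i + j × p ^ i ∣ a × p ^ j ∣ b

  private
    powerSplit-swap : ∀ {v} → PowerSplit v a b → PowerSplit v b a
    powerSplit-swap (i , j , v≡i+j , p^i∣a , p^j∣b) = j , i , trans v≡i+j (+-comm i j) , p^j∣b , p^i∣a

    powerSplit-shift : ∀ {v} → PowerSplit v a b → PowerSplit (suc v) (a * p) b
    powerSplit-shift {a} (i , j , v≡i+j , p^i∣a , p^j∣b) =
      suc i , j , cong suc v≡i+j , subst (p ^ suc i ∣_) (*-comm p a) (*-monoʳ-∣ p p^i∣a) , p^j∣b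

    powerSplit-step : ∀ {v} → (∀ a b → p ^ v ∣ a * b → PowerSplit v a b) →
                      p ∣ a → p ^ suc v ∣ a * b → PowerSplit (suc v) a b
    powerSplit-step {b = b} {v} split (divides a′ refl) p^[1+v]∣a′pb = powerSplit-shift (split a′ b p^v∣a′b)
      where
      a′pb≡pa′b : a′ * p * b ≡ p * (a′ * b)
      a′pb≡pa′b = trans (cong (_* b) (*-comm a′ p)) (*-assoc p a′ b)
      p^v∣a′b : p ^ v ∣ a′ * b
      p^v∣a′b = *-cancelˡ-∣ p (subst (p * p ^ v ∣_) a′pb≡pa′b p^[1+v]∣a′pb)

  p^v∣a*b⇒powerSplit : ∀ v a b → p ^ v ∣ a * b → PowerSplit v a b
  p^v∣a*b⇒powerSplit zero    a b _ = 0 , 0 , refl , 1∣ a , 1∣ b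
  p^v∣a*b⇒powerSplit (suc v) a b p^[1+v]∣ab
    with euclidsLemma a b p-prime (∣-trans (m∣m*n (p ^ v)) p^[1+v]∣ab)
  ... | inj₁ p∣a = powerSplit-step (p^v∣a*b⇒powerSplit v) p∣a p^[1+v]∣ab
  ... | inj₂ p∣b = powerSplit-swap (powerSplit-step (p^v∣a*b⇒powerSplit v) p∣b
                     (subst (p ^ suc v ∣_) (*-comm a b) p^[1+v]∣ab))

  -- ValuationBound m B expresses (p ∸ 1) · ν_p(m) ≤ B without computing ν_p.
  ValuationBound : ℕ → ℕ → Set
  ValuationBound m B = ∀ v → p ^ v ∣ m → (p ∸ 1) * v ≤ B

  valuationBound-mono : ValuationBound m A → A ≤ B → ValuationBound m B
  valuationBound-mono bound A≤B v p^v∣m = ≤-trans (bound v p^v∣m) A≤B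

  valuationBound-* : ValuationBound a A → ValuationBound b B → ValuationBound (a * b) (A + B)
  valuationBound-* {a} {A} {b} {B} boundA boundB v p^v∣ab with p^v∣a*b⇒powerSplit v a b p^v∣ab
  ... | i , j , refl , p^i∣a , p^j∣b = begin
    (p ∸ 1) * (i + j)          ≡⟨ *-distribˡ-+ (p ∸ 1) i j ⟩
    (p ∸ 1) * i + (p ∸ 1) * j  ≤⟨ +-mono-≤ (boundA i p^i∣a) (boundB j p^j∣b) ⟩
    A + B                      ∎
    where open ≤-Reasoning

  valuationBound-∤ : ¬ p ∣ m → ValuationBound m 0
  valuationBound-∤ p∤m zero    _         = ≤-reflexive (*-zeroʳ (p ∸ 1))
  valuationBound-∤ p∤m (suc v) p^[1+v]∣m = contradiction (∣-trans (m∣m*n (p ^ v)) p^[1+v]∣m) p∤m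

  valuationBound-^ : ValuationBound a A → ∀ e → ValuationBound (a ^ e) (e * A)
  valuationBound-^ bound zero    = valuationBound-∤ p∤1
  valuationBound-^ bound (suc e) = valuationBound-* bound (valuationBound-^ bound e)

  valuationBound-p : ValuationBound p (p ∸ 1)
  valuationBound-p zero          _ = ≤-trans (≤-reflexive (*-zeroʳ (p ∸ 1))) z≤n
  valuationBound-p (suc zero)    _ = ≤-reflexive (*-identityʳ (p ∸ 1))
  valuationBound-p (suc (suc v)) p^[2+v]∣p = contradiction (∣-trans (m∣m*n (p ^ v)) p*p^v∣1) p∤1
    where
    p*p^v∣1 : p * p ^ v ∣ 1
    p*p^v∣1 = *-cancelˡ-∣ p (subst (p * (p * p ^ v) ∣_) (sym (*-identityʳ p)) p^[2+v]∣p)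

  valuationBound-prod1 : ∀ {f g} → (∀ k → ValuationBound (f k) (g k)) →
                         ∀ n → ValuationBound (prod1 f n) (sum1 g n)
  valuationBound-prod1 bound zero    = valuationBound-∤ p∤1
  valuationBound-prod1 bound (suc n) = valuationBound-* (valuationBound-prod1 bound n) (bound (suc n))

  infix 4 _≃ₚ_
  data _≃ₚ_ (m n : ℕ) : Set where
    cofactor : ∀ u → ¬ p ∣ u → m ≡ n * u → m ≃ₚ n

  ≡⇒≃ₚ : m ≡ n → m ≃ₚ n
  ≡⇒≃ₚ {m} refl = cofactor 1 p∤1 (sym (*-identityʳ m))

  ≃ₚ-trans : l ≃ₚ m → m ≃ₚ n → l ≃ₚ n
  ≃ₚ-trans {n = n} (cofactor u p∤u refl) (cofactor w p∤w refl) =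
    cofactor (w * u) (p∤a∧p∤b⇒p∤a*b p∤w p∤u) (*-assoc n w u)

  ≃ₚ-preorder : Preorder _ _ _
  ≃ₚ-preorder = record
    { isPreorder = record { isEquivalence = isEquivalence ; reflexive = ≡⇒≃ₚ ; trans = ≃ₚ-trans } }

  module ≃ₚ-Reasoning = Relation.Binary.Reasoning.Preorder ≃ₚ-preorder

  *-monoʳ-≃ₚ : ∀ k → m ≃ₚ n → k * m ≃ₚ k * n
  *-monoʳ-≃ₚ {n = n} k (cofactor u p∤u refl) = cofactor u p∤u (sym (*-assoc k n u))

  p∤u⇒u*m≃ₚm : ∀ u → ¬ p ∣ u → u * m ≃ₚ m
  p∤u⇒u*m≃ₚm {m} u p∤u = cofactor u p∤u (*-comm u m)

  valuationBound-≃ₚ : m ≃ₚ n → ValuationBound n B → ValuationBound m B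
  valuationBound-≃ₚ {B = B} (cofactor u p∤u refl) bound =
    subst (ValuationBound _) (+-identityʳ B) (valuationBound-* bound (valuationBound-∤ p∤u))

  p∤1+p*d+r : ∀ d r → suc r < p → ¬ p ∣ suc (p * d + r)
  p∤1+p*d+r d r 1+r<p p∣1+pd+r = <⇒≱ 1+r<p (∣⇒≤ p∣1+r)
    where
    p∣1+r : p ∣ suc r
    p∣1+r = ∣m+n∣m⇒∣n (subst (p ∣_) (sym (+-suc (p * d) r)) p∣1+pd+r) (m∣m*n d)

  [p*d+r]!≃ₚ[p*d]! : ∀ d r → r < p → (p * d + r) ! ≃ₚ (p * d) !
  [p*d+r]!≃ₚ[p*d]! d zero    _     = ≡⇒≃ₚ (cong _! (+-identityʳ (p * d)))
  [p*d+r]!≃ₚ[p*d]! d (suc r) 1+r<p = begin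
    (p * d + suc r) !                ≡⟨ cong _! (+-suc (p * d) r) ⟩
    suc (p * d + r) * (p * d + r) !  ≲⟨ p∤u⇒u*m≃ₚm (suc (p * d + r)) (p∤1+p*d+r d r 1+r<p) ⟩
    (p * d + r) !                    ≲⟨ [p*d+r]!≃ₚ[p*d]! d r (<-trans (n<1+n r) 1+r<p) ⟩
    (p * d) !                        ∎
    where open ≃ₚ-Reasoning

  [p*d]!≃ₚp^d*d! : ∀ d → (p * d) ! ≃ₚ p ^ d * d !
  [p*d]!≃ₚp^d*d! zero    = ≡⇒≃ₚ (cong _! (*-zeroʳ p))
  [p*d]!≃ₚp^d*d! (suc d) = begin
    (p * suc d) !                          ≡⟨ cong _! p*[1+d]≡1+p*d+[p∸1] ⟩
    suc (p * d + (p ∸ 1)) * (p * d + (p ∸ 1)) !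
      ≲⟨ *-monoʳ-≃ₚ (suc (p * d + (p ∸ 1))) ([p*d+r]!≃ₚ[p*d]! d (p ∸ 1) (≤-reflexive (suc-pred p))) ⟩
    suc (p * d + (p ∸ 1)) * (p * d) !      ≡⟨ cong (_* (p * d) !) (sym p*[1+d]≡1+p*d+[p∸1]) ⟩
    p * suc d * (p * d) !                  ≲⟨ *-monoʳ-≃ₚ (p * suc d) ([p*d]!≃ₚp^d*d! d) ⟩
    p * suc d * (p ^ d * d !)              ≡⟨ regroup p d (p ^ d) (d !) ⟩
    p ^ suc d * suc d !                    ∎
    where
    open ≃ₚ-Reasoning
    p*[1+d]≡1+p*d+[p∸1] : p * suc d ≡ suc (p * d + (p ∸ 1))
    p*[1+d]≡1+p*d+[p∸1] = begin-equality
      p * suc d              ≡⟨ *-suc p d ⟩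
      p + p * d              ≡⟨ cong (_+ p * d) (sym (suc-pred p)) ⟩
      suc (p ∸ 1 + p * d)    ≡⟨ cong suc (+-comm (p ∸ 1) (p * d)) ⟩
      suc (p * d + (p ∸ 1))  ∎
    regroup : ∀ x y z w → x * (1 + y) * (z * w) ≡ x * z * (w + y * w)
    regroup = solve-∀

  k!≃ₚp^[k/p]*[k/p]! : ∀ k → k ! ≃ₚ p ^ (k / p) * (k / p) !
  k!≃ₚp^[k/p]*[k/p]! k = begin
    k !                          ≡⟨ cong _! k≡p*[k/p]+k%p ⟩
    (p * (k / p) + k % p) !      ≲⟨ [p*d+r]!≃ₚ[p*d]! (k / p) (k % p) (m%n<n k p) ⟩
    (p * (k / p)) !              ≲⟨ [p*d]!≃ₚp^d*d! (k / p) ⟩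
    p ^ (k / p) * (k / p) !      ∎
    where
    open ≃ₚ-Reasoning
    k≡p*[k/p]+k%p : k ≡ p * (k / p) + k % p
    k≡p*[k/p]+k%p = trans (m≡m%n+[m/n]*n k p) (trans (+-comm (k % p) _) (cong (_+ k % p) (*-comm (k / p) p)))

  valuationBound-! : ∀ k → ValuationBound (k !) k
  valuationBound-! = <-rec (λ k → ValuationBound (k !) k) bound
    where
    bound : ∀ k → (∀ {j} → j < k → ValuationBound (j !) j) → ValuationBound (k !) k
    bound zero      _   = valuationBound-∤ p∤1
    bound k@(suc _) rec = valuationBound-≃ₚ (k!≃ₚp^[k/p]*[k/p]! k)
      (valuationBound-mono (valuationBound-* p^d-bound d!-bound) d*[p∸1]+d≤k)
      where
      d : ℕ
      d = k / p
      p^d-bound : ValuationBound (p ^ d) (d * (p ∸ 1))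
      p^d-bound = valuationBound-^ valuationBound-p d
      d!-bound : ValuationBound (d !) d
      d!-bound = rec (m/n<m k p (nonTrivial⇒n>1 p))
      d*[p∸1]+d≤k : d * (p ∸ 1) + d ≤ k
      d*[p∸1]+d≤k = begin
        d * (p ∸ 1) + d      ≡⟨ +-comm (d * (p ∸ 1)) d ⟩
        d + d * (p ∸ 1)      ≡⟨ sym (*-suc d (p ∸ 1)) ⟩
        d * suc (p ∸ 1)      ≡⟨ cong (d *_) (suc-pred p) ⟩
        d * p                ≤⟨ m/n*n≤m k p ⟩
        k                    ∎
        where open ≤-Reasoning

mainTheorem8 : (p n : ℕ) → Prime p → n ≥ 1 →
    (v : ℕ) → IsValuation p (F3 n) v →
    (p ∸ 1) * v ≤ (suc n) ! ∸ 1
mainTheorem8 p n p-prime _ v (p^v∣F3[n] , _) = begin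
  (p ∸ 1) * v                       ≤⟨ valuationBound-F3 v p^v∣F3[n] ⟩
  sum1 (λ k → k ! * k) n            ≡⟨⟩
  suc (sum1 (λ k → k ! * k) n) ∸ 1  ≡⟨ cong (_∸ 1) (1+sum1[k!*k]≡[1+n]! n) ⟩
  suc n ! ∸ 1                       ∎
  where
  open ≤-Reasoning
  valuationBound-F3 : ValuationBound p-prime (F3 n) (sum1 (λ k → k ! * k) n)
  valuationBound-F3 = valuationBound-prod1 p-prime
    (λ k → valuationBound-^ p-prime (valuationBound-! p-prime k) (k !)) n
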